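{- Let $n,k\in\mathbb{N}$ with $k\le n$, let $\varepsilon_1\in[2/\sqrt n,1]$, and let $\mathcal D\subseteq\{0,1\}^{kn}$ with $\mu(\mathcal D)=\delta$. If $$\delta>\delta_k:=\bigl(2^k\,\tau_n(\varepsilon_1)\bigr)^{1/2^{k-1}}\quad\text{and}\quad 3k<\varepsilon_1^2n,$$ then $\mathcal V^{k,n}_{\pm\varepsilon_1}(\mathcal D)\ne\emptyset$.
   Context: $\mu$ is the uniform probability measure on the relevant Hamming cube; $\|x-y\|_1$ is Hamming distance and $|x|$ the Hamming weight. For $\varepsilon\in[0,1]$, $\tau_n(\varepsilon)=\mu(\{x\in\{0,1\}^n:|x|\le(1-\varepsilon)n/2\})$ $(=\mu(\{x:|x|\ge(1+\varepsilon)n/2\}))$. For $x\in\{0,1\}^n$, $\mathcal V^n_{\pm\varepsilon_1}(x)=\{x'\in\{0,1\}^n:(1-\varepsilon_1)n/2<\|x-x'\|_1<(1+\varepsilon_1)n/2\}$. Identifying $\{0,1\}^{kn}$ with $(\{0,1\}^n)^k$, $\mathcal V^{k,n}_{\pm\varepsilon_1}(\mathcal D)$ is the set of tuples $(x_0^i,x_1^i)_{i\in[k]}\in(\{0,1\}^n\times\{0,1\}^n)^k$ such that $x_0^i\in\mathcal V^n_{\pm\varepsilon_1}(x_1^i)$ for all $i\in[k]$ and the concatenation $(x^1_{\alpha_1},\dots,x^k_{\alpha_k})\in\mathcal D$ for every $\alpha\in\{0,1\}^k$.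
   Formalization: The parameter $\varepsilon_1$ ranges only over the rationals in $[2/\sqrt n,1]$. -}

module Defs where

open import Data.Bool using (Bool; true; false; if_then_else_; _xor_)
open import Data.Nat as ℕ using (ℕ; zero; suc)
open import Data.Integer using (+_)
open import Data.Rational using (ℚ; _/_; _*_; _+_; _-_; _≤_; _<_; 0ℚ; 1ℚ)
open import Data.List as List using (List; []; _∷_)
open import Data.Vec as Vec using (Vec; []; _∷_)
open import Data.Fin using (Fin)
open import Data.Product using (_×_; proj₁; proj₂)
open import Relation.Binary.PropositionalEquality using (_≡_)

Cube : ℕ → Set
Cube n = Vec Bool n

allCube : (n : ℕ) → List (Cube n)
allCube zero = [] ∷ []
allCube (suc n) = List.map (false ∷_) (allCube n) List.++ List.map (true ∷_) (allCube n)

ℕ→ℚ : ℕ → ℚ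
ℕ→ℚ m = + m / 1

_^ℚ_ : ℚ → ℕ → ℚ
q ^ℚ zero = 1ℚ
q ^ℚ suc m = q * (q ^ℚ m)

card : (n : ℕ) → (Cube n → Bool) → ℕ
card n P = List.length (List.filterᵇ P (allCube n))

μ : (n : ℕ) → (Cube n → Bool) → ℚ
μ n P = ℕ→ℚ (card n P) * ((+ 1 / 2) ^ℚ n)

weight : {n : ℕ} → Cube n → ℕ
weight x = Vec.countᵇ (λ b → b) x

hamming : {n : ℕ} → Cube n → Cube n → ℕ
hamming x y = weight (Vec.zipWith _xor_ x y)

_≤ᵇℚ_ : ℚ → ℚ → Bool
p ≤ᵇℚ q = Data.Rational._≤ᵇ_ p q

τ : (n : ℕ) → ℚ → ℚ
τ n ε = μ n (λ x → ℕ→ℚ (weight x) ≤ᵇℚ ((1ℚ - ε) * ℕ→ℚ n * (+ 1 / 2)))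

InV : (n : ℕ) → ℚ → Cube n → Cube n → Set
InV n ε x x' =
  ((1ℚ - ε) * ℕ→ℚ n * (+ 1 / 2) < ℕ→ℚ (hamming x x'))
  × (ℕ→ℚ (hamming x x') < (1ℚ + ε) * ℕ→ℚ n * (+ 1 / 2))

Tuple : ℕ → ℕ → Set
Tuple k n = Fin k → Cube n × Cube n

select : {k n : ℕ} → Tuple k n → Cube k → Cube (k ℕ.* n)
select t α = Vec.concat (Vec.tabulate (λ i → if Vec.lookup α i then proj₂ (t i) else proj₁ (t i)))

InVk : (k n : ℕ) → ℚ → (Cube (k ℕ.* n) → Bool) → Tuple k n → Set
InVk k n ε D t =
  ((i : Fin k) → InV n ε (proj₂ (t i)) (proj₁ (t i)))
  × ((α : Cube k) → D (select t α) ≡ true)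

{-# OPTIONS --safe #-}

-- Induction on k, writing {0,1}^(kn) = {0,1}^n × {0,1}^((k-1)n) and D_x for the fibre of D over
-- x ∈ {0,1}^n. Cauchy–Schwarz over the columns gives Σ_{x₀,x₁} μ(D_{x₀} ∩ D_{x₁}) ≥ 4ⁿ δ², while for
-- each x₀ at most 2·2ⁿτ points x₁ are at a distance outside the window (translation invariance and
-- the symmetry d ↦ n − d), so some pair inside the window has δ' = μ(D_{x₀} ∩ D_{x₁}) ≥ δ² − 2τδ; a
-- tuple for D_{x₀} ∩ D_{x₁} then extends by (x₀, x₁) to one for D. The density condition survives
-- because t ↦ t^j is j-Lipschitz on [0,1]: with j = 2^(k-2), (δ²)^j ≤ δ'^j + 2jτ turns
-- 2^k τ < δ^(2^(k-1)) into 2^(k-1) τ < δ'^(2^(k-2)), and for k = 1 it gives δ' ≥ δ(δ − 2τ) > 0.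

module Submission where

open import Defs

-- A block of its own, so that its ℕ operators do not clash with the ℚ ones that the statement
-- of mainTheorem11 uses unqualified.
module _ where

  open import Data.Bool using (Bool; true; false; _∧_; _∨_; T; if_then_else_; _xor_)
  open import Data.Bool.Properties using (∨-conicalˡ; ∨-conicalʳ; ∧-conicalˡ; ∧-conicalʳ)
  open import Data.Nat using (ℕ; zero; suc; _+_; _*_; _∸_; _^_; _≤_; _<_; z≤n; s≤s)
  open import Data.Nat.Properties hiding (+-cancelʳ-<)
  open import Data.Nat.Tactic.RingSolver using (solve-∀)
  import Data.Nat.Coprimality as Coprime
  import Data.Integer as ℤ
  import Data.Integer.Properties as ℤ
  open import Data.Rational as ℚ using (ℚ; mkℚ; _/_; 0ℚ; 1ℚ)
  import Data.Rational.Properties as ℚ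
  open import Data.Rational.Solver using (module +-*-Solver)
  open import Data.List as List using (List; []; _∷_; _++_; length)
  open import Data.List.Properties using (length-++; length-map)
  open import Data.Vec as Vec using ([]; _∷_)
  open import Data.Vec.Functional using () renaming (_∷_ to _∷ᵗ_)
  open import Data.Fin using (zero; suc)
  open import Data.Product using (_×_; _,_; proj₁; proj₂; ∃)
  open import Data.Sum using (inj₁; inj₂)
  open import Data.Unit using (tt)
  open import Function using (_∘_)
  open import Relation.Nullary using (¬_; contradiction)
  open import Relation.Binary.PropositionalEquality
  open +-*-Solver

  χ : Bool → ℕ
  χ true  = 1
  χ false = 0

  χ-≤1 : ∀ b → χ b ≤ 1
  χ-≤1 true  = ≤-refl
  χ-≤1 false = z≤n

  χ-∧ : ∀ a b → χ (a ∧ b) ≡ χ a * χ b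
  χ-∧ true  b = sym (*-identityˡ (χ b))
  χ-∧ false b = refl

  χ-∨ : ∀ a b → χ (a ∨ b) ≤ χ a + χ b
  χ-∨ true  b = s≤s z≤n
  χ-∨ false b = ≤-refl

  if-then-0-else-inv : ∀ {P : ℕ → Set} b {p} → ¬ P 0 → P (if b then 0 else p) → b ≡ false × P p
  if-then-0-else-inv true  ¬P0 P0 = contradiction P0 ¬P0
  if-then-0-else-inv false _   Pp = refl , Pp

  ∑ : {A : Set} → List A → (A → ℕ) → ℕ
  ∑ []       f = 0
  ∑ (x ∷ xs) f = f x + ∑ xs f

  syntax ∑ xs (λ x → e) = ∑[ x ∈ xs ] e

  module _ {A : Set} where

    ∑-++ : ∀ (xs ys : List A) f → ∑ (xs ++ ys) f ≡ ∑ xs f + ∑ ys f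
    ∑-++ []       ys f = refl
    ∑-++ (x ∷ xs) ys f = trans (cong (f x +_) (∑-++ xs ys f)) (sym (+-assoc (f x) _ _))

    ∑-cong : ∀ (xs : List A) {f g} → (∀ x → f x ≡ g x) → ∑ xs f ≡ ∑ xs g
    ∑-cong []       f≡g = refl
    ∑-cong (x ∷ xs) f≡g = cong₂ _+_ (f≡g x) (∑-cong xs f≡g)

    ∑-mono-≤ : ∀ (xs : List A) {f g} → (∀ x → f x ≤ g x) → ∑ xs f ≤ ∑ xs g
    ∑-mono-≤ []       f≤g = z≤n
    ∑-mono-≤ (x ∷ xs) f≤g = +-mono-≤ (f≤g x) (∑-mono-≤ xs f≤g)

    ∑-zero : ∀ (xs : List A) → ∑[ x ∈ xs ] 0 ≡ 0
    ∑-zero []       = refl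
    ∑-zero (x ∷ xs) = ∑-zero xs

    ∑-const : ∀ (xs : List A) c → ∑[ x ∈ xs ] c ≡ length xs * c
    ∑-const []       c = refl
    ∑-const (x ∷ xs) c = cong (c +_) (∑-const xs c)

    ∑-distrib-+ : ∀ (xs : List A) f g → ∑[ x ∈ xs ] (f x + g x) ≡ ∑ xs f + ∑ xs g
    ∑-distrib-+ []       f g = refl
    ∑-distrib-+ (x ∷ xs) f g =
      trans (cong (f x + g x +_) (∑-distrib-+ xs f g)) (+-+-interchange (f x) (g x) _ _)
      where
        +-+-interchange : ∀ a b c d → a + b + (c + d) ≡ a + c + (b + d)
        +-+-interchange = solve-∀

    ∑-*ˡ : ∀ (xs : List A) c f → ∑[ x ∈ xs ] (c * f x) ≡ c * ∑ xs f
    ∑-*ˡ []       c f = sym (*-zeroʳ c)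
    ∑-*ˡ (x ∷ xs) c f = trans (cong (c * f x +_) (∑-*ˡ xs c f)) (sym (*-distribˡ-+ c (f x) _))

    ∑-*ʳ : ∀ (xs : List A) c f → ∑[ x ∈ xs ] (f x * c) ≡ ∑ xs f * c
    ∑-*ʳ xs c f = begin
      ∑[ x ∈ xs ] (f x * c) ≡⟨ ∑-cong xs (λ x → *-comm (f x) c) ⟩
      ∑[ x ∈ xs ] (c * f x) ≡⟨ ∑-*ˡ xs c f ⟩
      c * ∑ xs f            ≡⟨ *-comm c _ ⟩
      ∑ xs f * c            ∎
      where open ≡-Reasoning

    ∑-≤-max : A → ∀ (xs : List A) f → ∃ λ y → ∑ xs f ≤ length xs * f y
    ∑-≤-max a []       f = a , z≤n
    ∑-≤-max a (x ∷ xs) f with ∑-≤-max a xs f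
    ... | y , ∑≤ with ≤-total (f x) (f y)
    ...   | inj₁ fx≤fy = y , +-mono-≤ fx≤fy ∑≤
    ...   | inj₂ fy≤fx = x , +-monoʳ-≤ (f x) (≤-trans ∑≤ (*-monoʳ-≤ (length xs) fy≤fx))

  module _ {A B : Set} where

    ∑-map : ∀ (g : A → B) (xs : List A) f → ∑ (List.map g xs) f ≡ ∑[ x ∈ xs ] f (g x)
    ∑-map g []       f = refl
    ∑-map g (x ∷ xs) f = cong (f (g x) +_) (∑-map g xs f)

    ∑-comm : ∀ (xs : List A) (ys : List B) (f : A → B → ℕ) →
             ∑[ x ∈ xs ] ∑[ y ∈ ys ] f x y ≡ ∑[ y ∈ ys ] ∑[ x ∈ xs ] f x y
    ∑-comm []       ys f = sym (∑-zero ys)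
    ∑-comm (x ∷ xs) ys f =
      trans (cong (∑ ys (f x) +_) (∑-comm xs ys f)) (sym (∑-distrib-+ ys (f x) _))

  2ab≤a²+b² : ∀ a b → 2 * (a * b) ≤ a * a + b * b
  2ab≤a²+b² a b with ≤-total a b
  ... | inj₁ a≤b with m≤n⇒∃[o]m+o≡n a≤b
  ...   | d , refl = m+n≤o⇒m≤o _ (≤-reflexive (expand a d))
    where
      expand : ∀ a d → 2 * (a * (a + d)) + d * d ≡ a * a + (a + d) * (a + d)
      expand = solve-∀
  2ab≤a²+b² a b | inj₂ b≤a with m≤n⇒∃[o]m+o≡n b≤a
  ...   | d , refl = m+n≤o⇒m≤o _ (≤-reflexive (expand b d))
    where
      expand : ∀ b d → 2 * ((b + d) * b) + d * d ≡ (b + d) * (b + d) + b * b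
      expand = solve-∀

  m*m≤n*m⇒m≤n : ∀ m n → m * m ≤ n * m → m ≤ n
  m*m≤n*m⇒m≤n zero    n _   = z≤n
  m*m≤n*m⇒m≤n (suc m) n m²≤ = *-cancelʳ-≤ (suc m) n (suc m) m²≤

  cauchy-schwarz : ∀ {A : Set} (xs : List A) f →
                   ∑ xs f * ∑ xs f ≤ length xs * ∑[ x ∈ xs ] (f x * f x)
  cauchy-schwarz []       f = z≤n
  cauchy-schwarz (x ∷ xs) f = begin
    (a + S) * (a + S)                  ≡⟨ square-+ a S ⟩
    a * a + 2 * (a * S) + S * S        ≤⟨ +-mono-≤ (+-monoʳ-≤ (a * a) cross) (cauchy-schwarz xs f) ⟩
    a * a + (L * (a * a) + Q) + L * Q  ≡⟨ regroup a L Q ⟩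
    suc L * (a * a + Q)                ∎
    where
      open ≤-Reasoning
      a = f x
      S = ∑ xs f
      L = length xs
      Q = ∑[ y ∈ xs ] (f y * f y)
      square-+ : ∀ a S → (a + S) * (a + S) ≡ a * a + 2 * (a * S) + S * S
      square-+ = solve-∀
      regroup : ∀ a L Q → a * a + (L * (a * a) + Q) + L * Q ≡ suc L * (a * a + Q)
      regroup = solve-∀
      cross : 2 * (a * S) ≤ L * (a * a) + Q
      cross = begin
        2 * (a * S)                   ≡⟨ cong (2 *_) (∑-*ˡ xs a f) ⟨
        2 * ∑[ y ∈ xs ] (a * f y)     ≡⟨ ∑-*ˡ xs 2 _ ⟨
        ∑[ y ∈ xs ] (2 * (a * f y))   ≤⟨ ∑-mono-≤ xs (λ y → 2ab≤a²+b² a (f y)) ⟩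
        ∑[ y ∈ xs ] (a * a + f y * f y) ≡⟨ ∑-distrib-+ xs _ _ ⟩
        ∑[ y ∈ xs ] (a * a) + Q       ≡⟨ cong (_+ Q) (∑-const xs (a * a)) ⟩
        L * (a * a) + Q               ∎

  length-allCube : ∀ n → length (allCube n) ≡ 2 ^ n
  length-allCube zero    = refl
  length-allCube (suc n) = begin
    length (List.map (false ∷_) (allCube n) ++ List.map (true ∷_) (allCube n))
      ≡⟨ length-++ (List.map (false ∷_) (allCube n)) ⟩
    length (List.map (false ∷_) (allCube n)) + length (List.map (true ∷_) (allCube n))
      ≡⟨ cong₂ _+_ (length-map (false ∷_) (allCube n)) (length-map (true ∷_) (allCube n)) ⟩
    length (allCube n) + length (allCube n)
      ≡⟨ cong₂ _+_ (length-allCube n) (trans (length-allCube n) (sym (+-identityʳ _))) ⟩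
    2 ^ n + (2 ^ n + 0) ∎
    where open ≡-Reasoning

  ∑-allCube-suc : ∀ n f → ∑ (allCube (suc n)) f ≡
                  ∑[ y ∈ allCube n ] f (false ∷ y) + ∑[ y ∈ allCube n ] f (true ∷ y)
  ∑-allCube-suc n f = trans (∑-++ (List.map (false ∷_) (allCube n)) _ f)
    (cong₂ _+_ (∑-map (false ∷_) (allCube n) f) (∑-map (true ∷_) (allCube n) f))

  ∑-allCube-++ : ∀ n m (f : Cube (n + m) → ℕ) →
                 ∑ (allCube (n + m)) f ≡ ∑[ x ∈ allCube n ] ∑[ z ∈ allCube m ] f (x Vec.++ z)
  ∑-allCube-++ zero    m f = sym (+-identityʳ _)
  ∑-allCube-++ (suc n) m f = begin
    ∑ (allCube (suc n + m)) f
      ≡⟨ ∑-allCube-suc (n + m) f ⟩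
    ∑[ v ∈ allCube (n + m) ] f (false ∷ v) + ∑[ v ∈ allCube (n + m) ] f (true ∷ v)
      ≡⟨ cong₂ _+_ (∑-allCube-++ n m (λ v → f (false ∷ v))) (∑-allCube-++ n m (λ v → f (true ∷ v))) ⟩
    ∑[ x ∈ allCube n ] ∑[ z ∈ allCube m ] f (false ∷ x Vec.++ z) +
    ∑[ x ∈ allCube n ] ∑[ z ∈ allCube m ] f (true ∷ x Vec.++ z)
      ≡⟨ ∑-allCube-suc n _ ⟨
    ∑[ x ∈ allCube (suc n) ] ∑[ z ∈ allCube m ] f (x Vec.++ z) ∎
    where open ≡-Reasoning

  card≡∑χ : ∀ n P → card n P ≡ ∑[ x ∈ allCube n ] χ (P x)
  card≡∑χ n P = length-filterᵇ (allCube n)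
    where
      length-filterᵇ : ∀ xs → length (List.filterᵇ P xs) ≡ ∑[ x ∈ xs ] χ (P x)
      length-filterᵇ []       = refl
      length-filterᵇ (x ∷ xs) with P x
      ... | true  = cong suc (length-filterᵇ xs)
      ... | false = length-filterᵇ xs

  card≤2^n : ∀ n P → card n P ≤ 2 ^ n
  card≤2^n n P = begin
    card n P                   ≡⟨ card≡∑χ n P ⟩
    ∑[ x ∈ allCube n ] χ (P x) ≤⟨ ∑-mono-≤ (allCube n) (λ x → χ-≤1 (P x)) ⟩
    ∑[ x ∈ allCube n ] 1       ≡⟨ ∑-const (allCube n) 1 ⟩
    length (allCube n) * 1     ≡⟨ *-identityʳ _ ⟩
    length (allCube n)         ≡⟨ length-allCube n ⟩
    2 ^ n                      ∎
    where open ≤-Reasoning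

  weight≤n : ∀ {n} (x : Cube n) → weight x ≤ n
  weight≤n []          = z≤n
  weight≤n (true ∷ x)  = s≤s (weight≤n x)
  weight≤n (false ∷ x) = m≤n⇒m≤1+n (weight≤n x)

  hamming≤n : ∀ {n} (x y : Cube n) → hamming x y ≤ n
  hamming≤n x y = weight≤n (Vec.zipWith _xor_ x y)

  ∑-hamming-translate : ∀ n (x : Cube n) (f : ℕ → ℕ) →
                        ∑[ y ∈ allCube n ] f (hamming y x) ≡ ∑[ y ∈ allCube n ] f (weight y)
  ∑-hamming-translate zero    []          f = refl
  ∑-hamming-translate (suc n) (false ∷ x) f = trans (∑-allCube-suc n _)
    (trans (cong₂ _+_ (∑-hamming-translate n x f) (∑-hamming-translate n x (f ∘ suc)))
           (sym (∑-allCube-suc n _)))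
  ∑-hamming-translate (suc n) (true ∷ x)  f = trans (∑-allCube-suc n _)
    (trans (cong₂ _+_ (∑-hamming-translate n x (f ∘ suc)) (∑-hamming-translate n x f))
    (trans (+-comm (∑[ y ∈ allCube n ] f (suc (weight y))) _) (sym (∑-allCube-suc n _))))

  ∑-weight-complement : ∀ n (f : ℕ → ℕ) →
                        ∑[ y ∈ allCube n ] f (n ∸ weight y) ≡ ∑[ y ∈ allCube n ] f (weight y)
  ∑-weight-complement zero    f = refl
  ∑-weight-complement (suc n) f = trans (∑-allCube-suc n _)
    (trans (cong₂ _+_ flip-false (∑-weight-complement n f))
    (trans (+-comm (∑[ y ∈ allCube n ] f (suc (weight y))) _) (sym (∑-allCube-suc n _))))
    where
      flip-false : ∑[ y ∈ allCube n ] f (suc n ∸ weight y) ≡ ∑[ y ∈ allCube n ] f (suc (weight y))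
      flip-false = trans (∑-cong (allCube n) (λ y → cong f (+-∸-assoc 1 (weight≤n y))))
                         (∑-weight-complement n (f ∘ suc))

  ℕ→ℚ≡mkℚ : ∀ m → ℕ→ℚ m ≡ mkℚ (ℤ.+ m) 0 (Coprime.sym (Coprime.1-coprimeTo m))
  ℕ→ℚ≡mkℚ m = ℚ.normalize-coprime (Coprime.sym (Coprime.1-coprimeTo m))

  ℕ→ℚ-+ : ∀ a b → ℕ→ℚ (a + b) ≡ ℕ→ℚ a ℚ.+ ℕ→ℚ b
  ℕ→ℚ-+ a b rewrite ℕ→ℚ≡mkℚ a | ℕ→ℚ≡mkℚ b = cong (_/ 1)
    (trans (sym (ℤ.pos-+ a b)) (cong₂ ℤ._+_ (sym (ℤ.*-identityʳ (ℤ.+ a))) (sym (ℤ.*-identityʳ (ℤ.+ b)))))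

  ℕ→ℚ-* : ∀ a b → ℕ→ℚ (a * b) ≡ ℕ→ℚ a ℚ.* ℕ→ℚ b
  ℕ→ℚ-* a b rewrite ℕ→ℚ≡mkℚ a | ℕ→ℚ≡mkℚ b = cong (_/ 1) (ℤ.pos-* a b)

  ℕ→ℚ-mono-≤ : ∀ {a b} → a ≤ b → ℕ→ℚ a ℚ.≤ ℕ→ℚ b
  ℕ→ℚ-mono-≤ {a} {b} a≤b rewrite ℕ→ℚ≡mkℚ a | ℕ→ℚ≡mkℚ b =
    ℚ.*≤* (ℤ.*-monoʳ-≤-nonNeg (ℤ.+ 1) (ℤ.+≤+ a≤b))

  ℕ→ℚ-nonNeg : ∀ a → 0ℚ ℚ.≤ ℕ→ℚ a
  ℕ→ℚ-nonNeg a = ℕ→ℚ-mono-≤ {0} {a} z≤n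

  +-cancelʳ-< : ∀ {p q} r → p ℚ.+ r ℚ.< q ℚ.+ r → p ℚ.< q
  +-cancelʳ-< r p+r<q+r = ℚ.≰⇒> λ q≤p → ℚ.<-irrefl refl (ℚ.<-≤-trans p+r<q+r (ℚ.+-monoˡ-≤ r q≤p))

  *-nonNeg : ∀ {p q} → 0ℚ ℚ.≤ p → 0ℚ ℚ.≤ q → 0ℚ ℚ.≤ p ℚ.* q
  *-nonNeg {p} {q} 0≤p 0≤q =
    ℚ.nonNegative⁻¹ _ {{ℚ.nonNeg*nonNeg⇒nonNeg p {{ℚ.nonNegative 0≤p}} q {{ℚ.nonNegative 0≤q}}}}

  *-monoˡ-≤-0≤ : ∀ {r p q} → 0ℚ ℚ.≤ r → p ℚ.≤ q → r ℚ.* p ℚ.≤ r ℚ.* q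
  *-monoˡ-≤-0≤ {r} 0≤r = ℚ.*-monoˡ-≤-nonNeg r {{ℚ.nonNegative 0≤r}}

  *-monoʳ-≤-0≤ : ∀ {r p q} → 0ℚ ℚ.≤ r → p ℚ.≤ q → p ℚ.* r ℚ.≤ q ℚ.* r
  *-monoʳ-≤-0≤ {r} 0≤r = ℚ.*-monoʳ-≤-nonNeg r {{ℚ.nonNegative 0≤r}}

  *-mono-≤-0≤ : ∀ {p q r s} → 0ℚ ℚ.≤ p → 0ℚ ℚ.≤ r → p ℚ.≤ q → r ℚ.≤ s → p ℚ.* r ℚ.≤ q ℚ.* s
  *-mono-≤-0≤ 0≤p 0≤r p≤q r≤s = ℚ.≤-trans (*-monoʳ-≤-0≤ 0≤r p≤q) (*-monoˡ-≤-0≤ (ℚ.≤-trans 0≤p p≤q) r≤s)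

  ^ℚ-+ : ∀ q a b → q ^ℚ (a + b) ≡ q ^ℚ a ℚ.* q ^ℚ b
  ^ℚ-+ q zero    b = sym (ℚ.*-identityˡ _)
  ^ℚ-+ q (suc a) b = trans (cong (q ℚ.*_) (^ℚ-+ q a b)) (sym (ℚ.*-assoc q _ _))

  ^ℚ-*-distrib : ∀ p q j → (p ℚ.* q) ^ℚ j ≡ p ^ℚ j ℚ.* q ^ℚ j
  ^ℚ-*-distrib p q zero    = refl
  ^ℚ-*-distrib p q (suc j) rewrite ^ℚ-*-distrib p q j =
    solve 4 (λ p q a b → (p :* q) :* (a :* b) := (p :* a) :* (q :* b)) refl p q (p ^ℚ j) (q ^ℚ j)

  ^ℚ-2*-square : ∀ q j → q ^ℚ (2 * j) ≡ (q ℚ.* q) ^ℚ j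
  ^ℚ-2*-square q j = begin
    q ^ℚ (j + (j + 0))          ≡⟨ ^ℚ-+ q j (j + 0) ⟩
    q ^ℚ j ℚ.* q ^ℚ (j + 0)     ≡⟨ cong (λ i → q ^ℚ j ℚ.* q ^ℚ i) (+-identityʳ j) ⟩
    q ^ℚ j ℚ.* q ^ℚ j           ≡⟨ ^ℚ-*-distrib q q j ⟨
    (q ℚ.* q) ^ℚ j              ∎
    where open ≡-Reasoning

  ^ℚ-nonNeg : ∀ {q} j → 0ℚ ℚ.≤ q → 0ℚ ℚ.≤ q ^ℚ j
  ^ℚ-nonNeg zero    0≤q = ℕ→ℚ-nonNeg 1
  ^ℚ-nonNeg (suc j) 0≤q = *-nonNeg 0≤q (^ℚ-nonNeg j 0≤q)

  ^ℚ-mono-≤ : ∀ {p q} j → 0ℚ ℚ.≤ p → p ℚ.≤ q → p ^ℚ j ℚ.≤ q ^ℚ j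
  ^ℚ-mono-≤ zero    0≤p p≤q = ℚ.≤-refl
  ^ℚ-mono-≤ (suc j) 0≤p p≤q = *-mono-≤-0≤ 0≤p (^ℚ-nonNeg j 0≤p) p≤q (^ℚ-mono-≤ j 0≤p p≤q)

  ^ℚ-≤1 : ∀ {q} j → 0ℚ ℚ.≤ q → q ℚ.≤ 1ℚ → q ^ℚ j ℚ.≤ 1ℚ
  ^ℚ-≤1 {q} j 0≤q q≤1 = ℚ.≤-trans (^ℚ-mono-≤ j 0≤q q≤1) (ℚ.≤-reflexive (1^j j))
    where
      1^j : ∀ j → 1ℚ ^ℚ j ≡ 1ℚ
      1^j zero    = refl
      1^j (suc j) = trans (ℚ.*-identityˡ _) (1^j j)

  ^ℚ-≤-base : ∀ {q} j → 0 < j → 0ℚ ℚ.≤ q → q ℚ.≤ 1ℚ → q ^ℚ j ℚ.≤ q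
  ^ℚ-≤-base {q} (suc j) _ 0≤q q≤1 =
    ℚ.≤-trans (*-monoˡ-≤-0≤ 0≤q (^ℚ-≤1 j 0≤q q≤1)) (ℚ.≤-reflexive (ℚ.*-identityʳ q))

  ^ℚ-lipschitz : ∀ {u v d} j → 0ℚ ℚ.≤ u → u ℚ.≤ 1ℚ → 0ℚ ℚ.≤ v → v ℚ.≤ 1ℚ → 0ℚ ℚ.≤ d →
                 u ℚ.≤ v ℚ.+ d → u ^ℚ j ℚ.≤ v ^ℚ j ℚ.+ ℕ→ℚ j ℚ.* d
  ^ℚ-lipschitz {u} {v} {d} zero 0≤u u≤1 0≤v v≤1 0≤d u≤v+d =
    ℚ.≤-reflexive (solve 1 (λ d → con 1ℚ := con 1ℚ :+ con 0ℚ :* d) refl d)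
  ^ℚ-lipschitz {u} {v} {d} (suc j) 0≤u u≤1 0≤v v≤1 0≤d u≤v+d = begin
    u ℚ.* u ^ℚ j
      ≤⟨ *-monoˡ-≤-0≤ 0≤u (^ℚ-lipschitz j 0≤u u≤1 0≤v v≤1 0≤d u≤v+d) ⟩
    u ℚ.* (v ^ℚ j ℚ.+ j′ ℚ.* d)
      ≡⟨ ℚ.*-distribˡ-+ u _ _ ⟩
    u ℚ.* v ^ℚ j ℚ.+ u ℚ.* (j′ ℚ.* d)
      ≤⟨ ℚ.+-mono-≤ (*-monoʳ-≤-0≤ (^ℚ-nonNeg j 0≤v) u≤v+d) (*-monoʳ-≤-0≤ (*-nonNeg (ℕ→ℚ-nonNeg j) 0≤d) u≤1) ⟩
    (v ℚ.+ d) ℚ.* v ^ℚ j ℚ.+ 1ℚ ℚ.* (j′ ℚ.* d)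
      ≡⟨ solve 4 (λ v d vj j′ → (v :+ d) :* vj :+ con 1ℚ :* (j′ :* d) := v :* vj :+ (d :* vj :+ j′ :* d))
                 refl v d (v ^ℚ j) j′ ⟩
    v ℚ.* v ^ℚ j ℚ.+ (d ℚ.* v ^ℚ j ℚ.+ j′ ℚ.* d)
      ≤⟨ ℚ.+-monoʳ-≤ (v ℚ.* v ^ℚ j) (ℚ.+-monoˡ-≤ (j′ ℚ.* d) (*-monoˡ-≤-0≤ 0≤d (^ℚ-≤1 j 0≤v v≤1))) ⟩
    v ℚ.* v ^ℚ j ℚ.+ (d ℚ.* 1ℚ ℚ.+ j′ ℚ.* d)
      ≡⟨ cong (v ℚ.* v ^ℚ j ℚ.+_) (solve 2 (λ d j′ → d :* con 1ℚ :+ j′ :* d := (con 1ℚ :+ j′) :* d) refl d j′) ⟩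
    v ℚ.* v ^ℚ j ℚ.+ (1ℚ ℚ.+ j′) ℚ.* d
      ≡⟨ cong (λ x → v ℚ.* v ^ℚ j ℚ.+ x ℚ.* d) (ℕ→ℚ-+ 1 j) ⟨
    v ℚ.* v ^ℚ j ℚ.+ ℕ→ℚ (suc j) ℚ.* d ∎
    where
      open ℚ.≤-Reasoning
      j′ = ℕ→ℚ j

  ½ : ℚ
  ½ = ℤ.+ 1 / 2

  0≤½ : 0ℚ ℚ.≤ ½
  0≤½ = ℚ.≤ᵇ⇒≤ tt

  2^n*½^n≡1 : ∀ n → ℕ→ℚ (2 ^ n) ℚ.* ½ ^ℚ n ≡ 1ℚ
  2^n*½^n≡1 zero    = refl
  2^n*½^n≡1 (suc n) = begin
    ℕ→ℚ (2 * 2 ^ n) ℚ.* (½ ℚ.* ½ ^ℚ n)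
      ≡⟨ cong (ℚ._* (½ ℚ.* ½ ^ℚ n)) (ℕ→ℚ-* 2 (2 ^ n)) ⟩
    ℕ→ℚ 2 ℚ.* ℕ→ℚ (2 ^ n) ℚ.* (½ ℚ.* ½ ^ℚ n)
      ≡⟨ solve 4 (λ a b c d → a :* b :* (c :* d) := a :* c :* (b :* d)) refl (ℕ→ℚ 2) (ℕ→ℚ (2 ^ n)) ½ (½ ^ℚ n) ⟩
    ℕ→ℚ 2 ℚ.* ½ ℚ.* (ℕ→ℚ (2 ^ n) ℚ.* ½ ^ℚ n)
      ≡⟨ cong (ℕ→ℚ 2 ℚ.* ½ ℚ.*_) (2^n*½^n≡1 n) ⟩
    1ℚ ∎
    where open ≡-Reasoning

  μ-nonNeg : ∀ n P → 0ℚ ℚ.≤ μ n P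
  μ-nonNeg n P = *-nonNeg (ℕ→ℚ-nonNeg (card n P)) (^ℚ-nonNeg n 0≤½)

  μ≤1 : ∀ n P → μ n P ℚ.≤ 1ℚ
  μ≤1 n P = ℚ.≤-trans (*-monoʳ-≤-0≤ (^ℚ-nonNeg n 0≤½) (ℕ→ℚ-mono-≤ (card≤2^n n P)))
                      (ℚ.≤-reflexive (2^n*½^n≡1 n))

  rescale-< : ∀ {c t M : ℕ} {a b : ℚ} → 0ℚ ℚ.≤ a → 0ℚ ℚ.≤ b → ℕ→ℚ M ℚ.* b ≡ 1ℚ →
              ℕ→ℚ 2 ℚ.* (ℕ→ℚ t ℚ.* a) ℚ.< ℕ→ℚ c ℚ.* (a ℚ.* b) → 2 * t * M < c
  rescale-< {c} {t} {M} {a} {b} 0≤a 0≤b Mb≡1 2ta<cab =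
    ≰⇒> λ c≤2tM → ℚ.<-irrefl refl (ℚ.<-≤-trans 2ta<cab (begin
      ℕ→ℚ c ℚ.* (a ℚ.* b)
        ≤⟨ *-monoʳ-≤-0≤ (*-nonNeg 0≤a 0≤b) (ℕ→ℚ-mono-≤ c≤2tM) ⟩
      ℕ→ℚ (2 * t * M) ℚ.* (a ℚ.* b)
        ≡⟨ cong (ℚ._* (a ℚ.* b)) (trans (ℕ→ℚ-* (2 * t) M) (cong (ℚ._* ℕ→ℚ M) (ℕ→ℚ-* 2 t))) ⟩
      ℕ→ℚ 2 ℚ.* ℕ→ℚ t ℚ.* ℕ→ℚ M ℚ.* (a ℚ.* b)
        ≡⟨ solve 5 (λ t M a b two → two :* t :* M :* (a :* b) := two :* (t :* a) :* (M :* b))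
                   refl (ℕ→ℚ t) (ℕ→ℚ M) a b (ℕ→ℚ 2) ⟩
      ℕ→ℚ 2 ℚ.* (ℕ→ℚ t ℚ.* a) ℚ.* (ℕ→ℚ M ℚ.* b)
        ≡⟨ trans (cong (ℕ→ℚ 2 ℚ.* (ℕ→ℚ t ℚ.* a) ℚ.*_) Mb≡1) (ℚ.*-identityʳ _) ⟩
      ℕ→ℚ 2 ℚ.* (ℕ→ℚ t ℚ.* a) ∎))
    where open ℚ.≤-Reasoning

  -- With a = 2⁻ⁿ and b = 2⁻ᵐ this turns the counting bound of good-pair into one on densities.
  rescale-square : ∀ {c d t M N : ℕ} {a b : ℚ} → 0ℚ ℚ.≤ a → 0ℚ ℚ.≤ b →
                   ℕ→ℚ N ℚ.* a ≡ 1ℚ → ℕ→ℚ M ℚ.* b ≡ 1ℚ →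
                   c * c ≤ M * (N * (N * d) + 2 * t * c) →
                   ℕ→ℚ c ℚ.* (a ℚ.* b) ℚ.* (ℕ→ℚ c ℚ.* (a ℚ.* b)) ℚ.≤
                   ℕ→ℚ d ℚ.* b ℚ.+ ℕ→ℚ 2 ℚ.* (ℕ→ℚ t ℚ.* a) ℚ.* (ℕ→ℚ c ℚ.* (a ℚ.* b))
  rescale-square {c} {d} {t} {M} {N} {a} {b} 0≤a 0≤b Na≡1 Mb≡1 c²≤ = begin
    c′ ℚ.* ab ℚ.* (c′ ℚ.* ab)
      ≡⟨ solve 2 (λ c ab → c :* ab :* (c :* ab) := c :* c :* (ab :* ab)) refl c′ ab ⟩
    c′ ℚ.* c′ ℚ.* (ab ℚ.* ab)
      ≤⟨ *-monoʳ-≤-0≤ (*-nonNeg 0≤ab 0≤ab) (subst₂ ℚ._≤_ (ℕ→ℚ-* c c) cast (ℕ→ℚ-mono-≤ c²≤)) ⟩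
    M′ ℚ.* (N′ ℚ.* (N′ ℚ.* d′) ℚ.+ ℕ→ℚ 2 ℚ.* t′ ℚ.* c′) ℚ.* (ab ℚ.* ab)
      ≡⟨ solve 8 (λ c d t M N a b two →
                    M :* (N :* (N :* d) :+ two :* t :* c) :* ((a :* b) :* (a :* b))
                 := M :* b :* (N :* a :* (N :* a :* (d :* b)) :+ two :* (t :* a) :* (c :* (a :* b))))
               refl c′ d′ t′ M′ N′ a b (ℕ→ℚ 2) ⟩
    M′ ℚ.* b ℚ.* (N′ ℚ.* a ℚ.* (N′ ℚ.* a ℚ.* (d′ ℚ.* b)) ℚ.+ ℕ→ℚ 2 ℚ.* (t′ ℚ.* a) ℚ.* (c′ ℚ.* ab))
      ≡⟨ cong₂ (λ x y → x ℚ.* (y ℚ.* (y ℚ.* (d′ ℚ.* b)) ℚ.+ ℕ→ℚ 2 ℚ.* (t′ ℚ.* a) ℚ.* (c′ ℚ.* ab))) Mb≡1 Na≡1 ⟩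
    1ℚ ℚ.* (1ℚ ℚ.* (1ℚ ℚ.* (d′ ℚ.* b)) ℚ.+ ℕ→ℚ 2 ℚ.* (t′ ℚ.* a) ℚ.* (c′ ℚ.* ab))
      ≡⟨ solve 2 (λ x y → con 1ℚ :* (con 1ℚ :* (con 1ℚ :* x) :+ y) := x :+ y) refl (d′ ℚ.* b) _ ⟩
    d′ ℚ.* b ℚ.+ ℕ→ℚ 2 ℚ.* (t′ ℚ.* a) ℚ.* (c′ ℚ.* ab) ∎
    where
      open ℚ.≤-Reasoning
      c′ = ℕ→ℚ c
      d′ = ℕ→ℚ d
      t′ = ℕ→ℚ t
      M′ = ℕ→ℚ M
      N′ = ℕ→ℚ N
      ab = a ℚ.* b
      0≤ab = *-nonNeg 0≤a 0≤b
      cast : ℕ→ℚ (M * (N * (N * d) + 2 * t * c)) ≡ M′ ℚ.* (N′ ℚ.* (N′ ℚ.* d′) ℚ.+ ℕ→ℚ 2 ℚ.* t′ ℚ.* c′)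
      cast = begin-equality
        ℕ→ℚ (M * (N * (N * d) + 2 * t * c))
          ≡⟨ ℕ→ℚ-* M _ ⟩
        M′ ℚ.* ℕ→ℚ (N * (N * d) + 2 * t * c)
          ≡⟨ cong (M′ ℚ.*_) (ℕ→ℚ-+ (N * (N * d)) _) ⟩
        M′ ℚ.* (ℕ→ℚ (N * (N * d)) ℚ.+ ℕ→ℚ (2 * t * c))
          ≡⟨ cong (λ x → M′ ℚ.* (x ℚ.+ ℕ→ℚ (2 * t * c))) (trans (ℕ→ℚ-* N (N * d)) (cong (N′ ℚ.*_) (ℕ→ℚ-* N d))) ⟩
        M′ ℚ.* (N′ ℚ.* (N′ ℚ.* d′) ℚ.+ ℕ→ℚ (2 * t * c))
          ≡⟨ cong (λ x → M′ ℚ.* (N′ ℚ.* (N′ ℚ.* d′) ℚ.+ x)) (trans (ℕ→ℚ-* (2 * t) c) (cong (ℚ._* c′) (ℕ→ℚ-* 2 t))) ⟩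
        M′ ℚ.* (N′ ℚ.* (N′ ℚ.* d′) ℚ.+ ℕ→ℚ 2 ℚ.* t′ ℚ.* c′) ∎

  -- The root-free form of δ > (2^k τ)^(1/2^(k-1)); for k = 0 only δ > 0 is kept, which is all
  -- that an empty tuple needs.
  DensityBound : ℚ → ℕ → ℚ → Set
  DensityBound τ zero    δ = 0ℚ ℚ.< δ
  DensityBound τ (suc k) δ = ℕ→ℚ (2 ^ suc k) ℚ.* τ ℚ.< δ ^ℚ (2 ^ k)

  module _ {τ : ℚ} (0≤τ : 0ℚ ℚ.≤ τ) where

    DensityBound-suc⇒2τ<δ : ∀ {δ} k → 0ℚ ℚ.≤ δ → δ ℚ.≤ 1ℚ →
                            DensityBound τ (suc k) δ → ℕ→ℚ 2 ℚ.* τ ℚ.< δ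
    DensityBound-suc⇒2τ<δ {δ} k 0≤δ δ≤1 bound = begin-strict
      ℕ→ℚ 2 ℚ.* τ           ≤⟨ *-monoʳ-≤-0≤ 0≤τ (ℕ→ℚ-mono-≤ (*-monoʳ-≤ 2 (m^n>0 2 k))) ⟩
      ℕ→ℚ (2 ^ suc k) ℚ.* τ <⟨ bound ⟩
      δ ^ℚ (2 ^ k)          ≤⟨ ^ℚ-≤-base (2 ^ k) (m^n>0 2 k) 0≤δ δ≤1 ⟩
      δ                     ∎
      where open ℚ.≤-Reasoning

    DensityBound-step : ∀ {δ δ'} k → 0ℚ ℚ.≤ δ → δ ℚ.≤ 1ℚ → 0ℚ ℚ.≤ δ' → δ' ℚ.≤ 1ℚ →
                        δ ℚ.* δ ℚ.≤ δ' ℚ.+ ℕ→ℚ 2 ℚ.* τ ℚ.* δ →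
                        DensityBound τ (suc k) δ → DensityBound τ k δ'
    DensityBound-step {δ} {δ'} zero 0≤δ δ≤1 0≤δ' δ'≤1 δ²≤ bound =
      +-cancelʳ-< (2τ ℚ.* δ) (begin-strict
        0ℚ ℚ.+ 2τ ℚ.* δ ≡⟨ ℚ.+-identityˡ _ ⟩
        2τ ℚ.* δ        <⟨ ℚ.*-monoˡ-<-pos δ {{ℚ.positive 0<δ}} 2τ<δ ⟩
        δ ℚ.* δ         ≤⟨ δ²≤ ⟩
        δ' ℚ.+ 2τ ℚ.* δ ∎)
      where
        open ℚ.≤-Reasoning
        2τ = ℕ→ℚ 2 ℚ.* τ
        2τ<δ = DensityBound-suc⇒2τ<δ zero 0≤δ δ≤1 bound
        0<δ = ℚ.≤-<-trans (*-nonNeg (ℕ→ℚ-nonNeg 2) 0≤τ) 2τ<δ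
    DensityBound-step {δ} {δ'} (suc k) 0≤δ δ≤1 0≤δ' δ'≤1 δ²≤ bound =
      +-cancelʳ-< X (begin-strict
        X ℚ.+ X                       ≡⟨ ℕ→ℚ-double (2 ^ suc k) ⟨
        ℕ→ℚ (2 ^ suc (suc k)) ℚ.* τ   <⟨ bound ⟩
        δ ^ℚ (2 * 2 ^ k)              ≡⟨ ^ℚ-2*-square δ (2 ^ k) ⟩
        (δ ℚ.* δ) ^ℚ (2 ^ k)          ≤⟨ ^ℚ-lipschitz (2 ^ k) (*-nonNeg 0≤δ 0≤δ) (*-mono-≤-0≤ 0≤δ 0≤δ δ≤1 δ≤1)
                                                     0≤δ' δ'≤1 0≤2τ δ²≤δ'+2τ ⟩
        δ' ^ℚ (2 ^ k) ℚ.+ ℕ→ℚ (2 ^ k) ℚ.* 2τ ≡⟨ cong (δ' ^ℚ (2 ^ k) ℚ.+_) X≡2^k*2τ ⟨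
        δ' ^ℚ (2 ^ k) ℚ.+ X           ∎)
      where
        open ℚ.≤-Reasoning
        2τ = ℕ→ℚ 2 ℚ.* τ
        0≤2τ = *-nonNeg (ℕ→ℚ-nonNeg 2) 0≤τ
        X = ℕ→ℚ (2 ^ suc k) ℚ.* τ
        ℕ→ℚ-double : ∀ m → ℕ→ℚ (2 * m) ℚ.* τ ≡ ℕ→ℚ m ℚ.* τ ℚ.+ ℕ→ℚ m ℚ.* τ
        ℕ→ℚ-double m = trans (cong (ℚ._* τ) (ℕ→ℚ-* 2 m))
          (solve 2 (λ m τ → con (ℕ→ℚ 2) :* m :* τ := m :* τ :+ m :* τ) refl (ℕ→ℚ m) τ)
        X≡2^k*2τ : X ≡ ℕ→ℚ (2 ^ k) ℚ.* 2τ
        X≡2^k*2τ = trans (cong (ℚ._* τ) (ℕ→ℚ-* 2 (2 ^ k)))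
          (solve 2 (λ m τ → con (ℕ→ℚ 2) :* m :* τ := m :* (con (ℕ→ℚ 2) :* τ)) refl (ℕ→ℚ (2 ^ k)) τ)
        δ²≤δ'+2τ : δ ℚ.* δ ℚ.≤ δ' ℚ.+ 2τ
        δ²≤δ'+2τ = ℚ.≤-trans δ²≤ (ℚ.+-monoʳ-≤ δ' (ℚ.≤-trans (*-monoˡ-≤-0≤ 0≤2τ δ≤1) (ℚ.≤-reflexive (ℚ.*-identityʳ 2τ))))

  module Window (n : ℕ) (ε : ℚ) where

    lower : ℚ
    lower = (1ℚ ℚ.- ε) ℚ.* ℕ→ℚ n ℚ.* ½

    atMostLower : ℕ → Bool
    atMostLower w = ℕ→ℚ w ≤ᵇℚ lower

    #atMostLower : ℕ
    #atMostLower = card n (atMostLower ∘ weight)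

    -- A distance lies strictly inside the window iff neither it nor its complement to n is at most
    -- the lower threshold, since (1 + ε) n / 2 = n - lower.
    outOfWindow : Cube n → Cube n → Bool
    outOfWindow x₀ x₁ = atMostLower (hamming x₁ x₀) ∨ atMostLower (n ∸ hamming x₁ x₀)

    outOfWindow-count : ∀ x₀ → ∑[ x₁ ∈ allCube n ] χ (outOfWindow x₀ x₁) ≤ 2 * #atMostLower
    outOfWindow-count x₀ = begin
      ∑[ x₁ ∈ allCube n ] χ (outOfWindow x₀ x₁)
        ≤⟨ ∑-mono-≤ (allCube n) (λ x₁ → χ-∨ (atMostLower (hamming x₁ x₀)) _) ⟩
      ∑[ x₁ ∈ allCube n ] (χ (atMostLower (hamming x₁ x₀)) + χ (atMostLower (n ∸ hamming x₁ x₀)))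
        ≡⟨ ∑-distrib-+ (allCube n) _ _ ⟩
      ∑[ x₁ ∈ allCube n ] χ (atMostLower (hamming x₁ x₀)) +
      ∑[ x₁ ∈ allCube n ] χ (atMostLower (n ∸ hamming x₁ x₀))
        ≡⟨ cong₂ _+_ (∑-hamming-translate n x₀ (χ ∘ atMostLower))
                     (trans (∑-hamming-translate n x₀ (λ w → χ (atMostLower (n ∸ w))))
                            (∑-weight-complement n (χ ∘ atMostLower))) ⟩
      ∑[ y ∈ allCube n ] χ (atMostLower (weight y)) + ∑[ y ∈ allCube n ] χ (atMostLower (weight y))
        ≡⟨ cong₂ _+_ (card≡∑χ n _) (card≡∑χ n _) ⟨
      #atMostLower + #atMostLower
        ≡⟨ cong (#atMostLower +_) (+-identityʳ #atMostLower) ⟨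
      2 * #atMostLower ∎
      where open ≤-Reasoning

    inWindow⇒InV : ∀ x₀ x₁ → outOfWindow x₀ x₁ ≡ false → InV n ε x₁ x₀
    inWindow⇒InV x₀ x₁ inWindow = above-lower h h≰ , h<upper
      where
        h = hamming x₁ x₀
        h≰ = ∨-conicalˡ (atMostLower h) (atMostLower (n ∸ h)) inWindow
        n∸h≰ = ∨-conicalʳ (atMostLower h) (atMostLower (n ∸ h)) inWindow
        above-lower : ∀ w → atMostLower w ≡ false → lower ℚ.< ℕ→ℚ w
        above-lower w w≰ = ℚ.≰⇒> (λ w≤ → subst T w≰ (ℚ.≤⇒≤ᵇ w≤))
        n∸h+h≡n : ℕ→ℚ (n ∸ h) ℚ.+ ℕ→ℚ h ≡ ℕ→ℚ n
        n∸h+h≡n = trans (sym (ℕ→ℚ-+ (n ∸ h) h)) (cong ℕ→ℚ (m∸n+n≡m (hamming≤n x₁ x₀)))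
        h<upper : ℕ→ℚ h ℚ.< (1ℚ ℚ.+ ε) ℚ.* ℕ→ℚ n ℚ.* ½
        h<upper = begin-strict
          ℕ→ℚ h
            ≡⟨ solve 2 (λ l h → h := (l :+ h) :- l) refl lower (ℕ→ℚ h) ⟩
          (lower ℚ.+ ℕ→ℚ h) ℚ.- lower
            <⟨ ℚ.+-monoˡ-< (ℚ.- lower) (ℚ.+-monoˡ-< (ℕ→ℚ h) (above-lower (n ∸ h) n∸h≰)) ⟩
          (ℕ→ℚ (n ∸ h) ℚ.+ ℕ→ℚ h) ℚ.- lower
            ≡⟨ cong (ℚ._- lower) n∸h+h≡n ⟩
          ℕ→ℚ n ℚ.- lower
            ≡⟨ solve 2 (λ n ε → n :- (con 1ℚ :- ε) :* n :* con ½ := (con 1ℚ :+ ε) :* n :* con ½) refl (ℕ→ℚ n) ε ⟩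
          (1ℚ ℚ.+ ε) ℚ.* ℕ→ℚ n ℚ.* ½ ∎
          where open ℚ.≤-Reasoning

  module Fibres (n m : ℕ) (ε : ℚ) (D : Cube (n + m) → Bool) where
    open Window n ε

    #D : ℕ
    #D = card (n + m) D

    fibre : Cube n → Cube m → ℕ
    fibre x z = χ (D (x Vec.++ z))

    row : Cube n → ℕ
    row x = ∑[ z ∈ allCube m ] fibre x z

    column : Cube m → ℕ
    column z = ∑[ x ∈ allCube n ] fibre x z

    fibreMeet : Cube n → Cube n → Cube m → Bool
    fibreMeet x₀ x₁ z = D (x₀ Vec.++ z) ∧ D (x₁ Vec.++ z)

    #meet : Cube n → Cube n → ℕ
    #meet x₀ x₁ = ∑[ z ∈ allCube m ] (fibre x₀ z * fibre x₁ z)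

    #goodMeet : Cube n → Cube n → ℕ
    #goodMeet x₀ x₁ = if outOfWindow x₀ x₁ then 0 else #meet x₀ x₁

    card-fibreMeet : ∀ x₀ x₁ → card m (fibreMeet x₀ x₁) ≡ #meet x₀ x₁
    card-fibreMeet x₀ x₁ = trans (card≡∑χ m _) (∑-cong (allCube m) (λ z → χ-∧ (D (x₀ Vec.++ z)) _))

    #D≡∑row : #D ≡ ∑ (allCube n) row
    #D≡∑row = trans (card≡∑χ (n + m) D) (∑-allCube-++ n m (χ ∘ D))

    #D≡∑column : #D ≡ ∑ (allCube m) column
    #D≡∑column = trans #D≡∑row (∑-comm (allCube n) (allCube m) fibre)

    ∑column²≡∑∑#meet : ∑[ z ∈ allCube m ] (column z * column z) ≡
                         ∑[ x₀ ∈ allCube n ] ∑[ x₁ ∈ allCube n ] #meet x₀ x₁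
    ∑column²≡∑∑#meet = begin
      ∑[ z ∈ Z ] (column z * column z)
        ≡⟨ ∑-cong Z (λ z → ∑-*ʳ X (column z) (λ x₀ → fibre x₀ z)) ⟨
      ∑[ z ∈ Z ] ∑[ x₀ ∈ X ] (fibre x₀ z * column z)
        ≡⟨ ∑-cong Z (λ z → ∑-cong X (λ x₀ → ∑-*ˡ X (fibre x₀ z) (λ x₁ → fibre x₁ z))) ⟨
      ∑[ z ∈ Z ] ∑[ x₀ ∈ X ] ∑[ x₁ ∈ X ] (fibre x₀ z * fibre x₁ z)
        ≡⟨ ∑-comm X Z _ ⟨
      ∑[ x₀ ∈ X ] ∑[ z ∈ Z ] ∑[ x₁ ∈ X ] (fibre x₀ z * fibre x₁ z)
        ≡⟨ ∑-cong X (λ x₀ → ∑-comm Z X _) ⟩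
      ∑[ x₀ ∈ X ] ∑[ x₁ ∈ X ] #meet x₀ x₁ ∎
      where
        open ≡-Reasoning
        X = allCube n
        Z = allCube m

    #D²≤∑∑#meet : #D * #D ≤ 2 ^ m * ∑[ x₀ ∈ allCube n ] ∑[ x₁ ∈ allCube n ] #meet x₀ x₁
    #D²≤∑∑#meet = begin
      #D * #D                                           ≡⟨ cong₂ _*_ #D≡∑column #D≡∑column ⟩
      ∑ Z column * ∑ Z column                           ≤⟨ cauchy-schwarz Z column ⟩
      length Z * ∑[ z ∈ Z ] (column z * column z)       ≡⟨ cong₂ _*_ (length-allCube m) ∑column²≡∑∑#meet ⟩
      2 ^ m * ∑[ x₀ ∈ allCube n ] ∑[ x₁ ∈ allCube n ] #meet x₀ x₁ ∎
      where
        open ≤-Reasoning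
        Z = allCube m

    #meet≤#goodMeet+row : ∀ x₀ x₁ → #meet x₀ x₁ ≤ #goodMeet x₀ x₁ + χ (outOfWindow x₀ x₁) * row x₀
    #meet≤#goodMeet+row x₀ x₁ with outOfWindow x₀ x₁
    ... | true  = ≤-trans (∑-mono-≤ (allCube m) #meet≤fibre) (≤-reflexive (sym (*-identityˡ (row x₀))))
      where
        #meet≤fibre : ∀ z → fibre x₀ z * fibre x₁ z ≤ fibre x₀ z
        #meet≤fibre z = ≤-trans (*-monoʳ-≤ (fibre x₀ z) (χ-≤1 (D (x₁ Vec.++ z))))
                                (≤-reflexive (*-identityʳ _))
    ... | false = m≤m+n (#meet x₀ x₁) 0

    ∑∑#meet≤ : ∑[ x₀ ∈ allCube n ] ∑[ x₁ ∈ allCube n ] #meet x₀ x₁ ≤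
                 ∑[ x₀ ∈ allCube n ] ∑[ x₁ ∈ allCube n ] #goodMeet x₀ x₁ + 2 * #atMostLower * #D
    ∑∑#meet≤ = begin
      ∑[ x₀ ∈ X ] ∑[ x₁ ∈ X ] #meet x₀ x₁
        ≤⟨ ∑-mono-≤ X (λ x₀ → ∑-mono-≤ X (#meet≤#goodMeet+row x₀)) ⟩
      ∑[ x₀ ∈ X ] ∑[ x₁ ∈ X ] (#goodMeet x₀ x₁ + χ (outOfWindow x₀ x₁) * row x₀)
        ≡⟨ ∑-cong X (λ x₀ → ∑-distrib-+ X _ _) ⟩
      ∑[ x₀ ∈ X ] (∑[ x₁ ∈ X ] #goodMeet x₀ x₁ + ∑[ x₁ ∈ X ] (χ (outOfWindow x₀ x₁) * row x₀))
        ≡⟨ ∑-distrib-+ X _ _ ⟩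
      G + ∑[ x₀ ∈ X ] ∑[ x₁ ∈ X ] (χ (outOfWindow x₀ x₁) * row x₀)
        ≡⟨ cong (G +_) (∑-cong X (λ x₀ → ∑-*ʳ X (row x₀) (χ ∘ outOfWindow x₀))) ⟩
      G + ∑[ x₀ ∈ X ] (∑[ x₁ ∈ X ] χ (outOfWindow x₀ x₁) * row x₀)
        ≤⟨ +-monoʳ-≤ G (∑-mono-≤ X (λ x₀ → *-monoˡ-≤ (row x₀) (outOfWindow-count x₀))) ⟩
      G + ∑[ x₀ ∈ X ] (2 * #atMostLower * row x₀)
        ≡⟨ cong (G +_) (∑-*ˡ X (2 * #atMostLower) row) ⟩
      G + 2 * #atMostLower * ∑ X row
        ≡⟨ cong (λ r → G + 2 * #atMostLower * r) #D≡∑row ⟨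
      G + 2 * #atMostLower * #D ∎
      where
        open ≤-Reasoning
        X = allCube n
        G = ∑[ x₀ ∈ X ] ∑[ x₁ ∈ X ] #goodMeet x₀ x₁

    maximal-#goodMeet : ∃ λ x₀ → ∃ λ x₁ →
      #D * #D ≤ 2 ^ m * (2 ^ n * (2 ^ n * #goodMeet x₀ x₁) + 2 * #atMostLower * #D)
    maximal-#goodMeet = x₀ , x₁ , (begin
      #D * #D                                        ≤⟨ #D²≤∑∑#meet ⟩
      2 ^ m * ∑[ x₀ ∈ X ] ∑[ x₁ ∈ X ] #meet x₀ x₁   ≤⟨ *-monoʳ-≤ (2 ^ m) ∑∑#meet≤ ⟩
      2 ^ m * (G + B)                                ≤⟨ *-monoʳ-≤ (2 ^ m) (+-monoˡ-≤ B G≤) ⟩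
      2 ^ m * (2 ^ n * (2 ^ n * #goodMeet x₀ x₁) + B) ∎)
      where
        open ≤-Reasoning
        X = allCube n
        max₀ = ∑-≤-max (Vec.replicate n false) X (λ x₀ → ∑[ x₁ ∈ X ] #goodMeet x₀ x₁)
        x₀ = proj₁ max₀
        max₁ = ∑-≤-max (Vec.replicate n false) X (#goodMeet x₀)
        x₁ = proj₁ max₁
        G = ∑[ x₀ ∈ X ] ∑[ x₁ ∈ X ] #goodMeet x₀ x₁
        B = 2 * #atMostLower * #D
        G≤ : G ≤ 2 ^ n * (2 ^ n * #goodMeet x₀ x₁)
        G≤ = subst (λ N → G ≤ N * (N * #goodMeet x₀ x₁)) (length-allCube n)
               (≤-trans (proj₂ max₀) (*-monoʳ-≤ (length X) (proj₂ max₁)))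

    good-pair : 2 * #atMostLower * 2 ^ m < #D → ∃ λ x₀ → ∃ λ x₁ → outOfWindow x₀ x₁ ≡ false ×
      #D * #D ≤ 2 ^ m * (2 ^ n * (2 ^ n * #meet x₀ x₁) + 2 * #atMostLower * #D)
    good-pair #D-large = x₀ , x₁ , if-then-0-else-inv {P = Bounds} (outOfWindow x₀ x₁) #D²≰ bound
      where
        x₀ = proj₁ maximal-#goodMeet
        x₁ = proj₁ (proj₂ maximal-#goodMeet)
        bound = proj₂ (proj₂ maximal-#goodMeet)
        Bounds : ℕ → Set
        Bounds g = #D * #D ≤ 2 ^ m * (2 ^ n * (2 ^ n * g) + 2 * #atMostLower * #D)
        #D²≰ : ¬ Bounds 0
        #D²≰ #D²≤ = <⇒≱ #D-large
          (m*m≤n*m⇒m≤n #D _ (≤-trans #D²≤ (≤-reflexive (reassoc (2 ^ m) (2 ^ n) #atMostLower #D))))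
          where
            reassoc : ∀ M N t c → M * (N * (N * 0) + 2 * t * c) ≡ 2 * t * M * c
            reassoc = solve-∀

    good-pair-density : ℕ→ℚ 2 ℚ.* τ n ε ℚ.< μ (n + m) D →
      ∃ λ x₀ → ∃ λ x₁ → InV n ε x₁ x₀ ×
        μ (n + m) D ℚ.* μ (n + m) D ℚ.≤ μ m (fibreMeet x₀ x₁) ℚ.+ ℕ→ℚ 2 ℚ.* τ n ε ℚ.* μ (n + m) D
    good-pair-density 2τ<δ = x₀ , x₁ , inWindow⇒InV x₀ x₁ inWindow , (begin
      δ ℚ.* δ
        ≡⟨ cong₂ ℚ._*_ δ≡ δ≡ ⟩
      ℕ→ℚ #D ℚ.* (½ⁿ ℚ.* ½ᵐ) ℚ.* (ℕ→ℚ #D ℚ.* (½ⁿ ℚ.* ½ᵐ))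
        ≤⟨ rescale-square {#D} {#meet x₀ x₁} {#atMostLower} {2 ^ m} {2 ^ n}
                          0≤½ⁿ 0≤½ᵐ (2^n*½^n≡1 n) (2^n*½^n≡1 m) #D²≤ ⟩
      ℕ→ℚ (#meet x₀ x₁) ℚ.* ½ᵐ ℚ.+ ℕ→ℚ 2 ℚ.* τ n ε ℚ.* (ℕ→ℚ #D ℚ.* (½ⁿ ℚ.* ½ᵐ))
        ≡⟨ cong₂ (λ c x → ℕ→ℚ c ℚ.* ½ᵐ ℚ.+ ℕ→ℚ 2 ℚ.* τ n ε ℚ.* x) (card-fibreMeet x₀ x₁) δ≡ ⟨
      μ m (fibreMeet x₀ x₁) ℚ.+ ℕ→ℚ 2 ℚ.* τ n ε ℚ.* δ ∎)
      where
        open ℚ.≤-Reasoning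
        δ = μ (n + m) D
        ½ⁿ = ½ ^ℚ n
        ½ᵐ = ½ ^ℚ m
        0≤½ⁿ = ^ℚ-nonNeg n 0≤½
        0≤½ᵐ = ^ℚ-nonNeg m 0≤½
        δ≡ : δ ≡ ℕ→ℚ #D ℚ.* (½ⁿ ℚ.* ½ᵐ)
        δ≡ = cong (ℕ→ℚ #D ℚ.*_) (^ℚ-+ ½ n m)
        pair = good-pair
          (rescale-< {#D} {#atMostLower} {2 ^ m} 0≤½ⁿ 0≤½ᵐ (2^n*½^n≡1 m) (subst (_ ℚ.<_) δ≡ 2τ<δ))
        x₀ = proj₁ pair
        x₁ = proj₁ (proj₂ pair)
        inWindow = proj₁ (proj₂ (proj₂ pair))
        #D²≤ = proj₂ (proj₂ (proj₂ pair))

  ^ℚ2-cancel-< : ∀ {p q} → 0ℚ ℚ.≤ q → p ^ℚ 2 ℚ.< q ^ℚ 2 → p ℚ.< q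
  ^ℚ2-cancel-< 0≤q p²<q² = ℚ.≰⇒> λ q≤p → ℚ.<-irrefl refl (ℚ.<-≤-trans p²<q² (^ℚ-mono-≤ 2 0≤q q≤p))

  DensityBound-from-square : ∀ {τ δ} k → 0ℚ ℚ.≤ τ → 0ℚ ℚ.≤ δ →
                             (ℕ→ℚ (2 ^ k) ℚ.* τ) ^ℚ 2 ℚ.< δ ^ℚ (2 ^ k) → DensityBound τ k δ
  DensityBound-from-square {τ} {δ} zero 0≤τ 0≤δ τ²<δ =
    ℚ.≤-<-trans (^ℚ-nonNeg 2 (*-nonNeg (ℕ→ℚ-nonNeg 1) 0≤τ)) (subst (_ ℚ.<_) (ℚ.*-identityʳ δ) τ²<δ)
  DensityBound-from-square {τ} {δ} (suc k) 0≤τ 0≤δ square< =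
    ^ℚ2-cancel-< (^ℚ-nonNeg (2 ^ k) 0≤δ) (subst (_ ℚ.<_) δ^2j≡[δ^j]² square<)
    where
      j = 2 ^ k
      δ^2j≡[δ^j]² : δ ^ℚ (j + (j + 0)) ≡ (δ ^ℚ j) ^ℚ 2
      δ^2j≡[δ^j]² = trans (^ℚ-+ δ j (j + 0)) (cong (δ ^ℚ j ℚ.*_) (^ℚ-+ δ j 0))

  InVk-∷ : ∀ {k n ε D} {x₀ x₁ : Cube n} {t : Tuple k n} → InV n ε x₁ x₀ →
           InVk k n ε (λ z → D (x₀ Vec.++ z) ∧ D (x₁ Vec.++ z)) t →
           InVk (suc k) n ε D ((x₀ , x₁) ∷ᵗ t)
  InVk-∷ {k} {n} {ε} {D} {x₀} {x₁} {t} x₁∈V (t∈V , t⊆D) = x∈V , x⊆D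
    where
      x∈V : ∀ i → InV n ε (proj₂ (((x₀ , x₁) ∷ᵗ t) i)) (proj₁ (((x₀ , x₁) ∷ᵗ t) i))
      x∈V zero    = x₁∈V
      x∈V (suc i) = t∈V i
      x⊆D : ∀ α → D (select ((x₀ , x₁) ∷ᵗ t) α) ≡ true
      x⊆D (false ∷ α) = ∧-conicalˡ (D (x₀ Vec.++ select t α)) _ (t⊆D α)
      x⊆D (true  ∷ α) = ∧-conicalʳ (D (x₀ Vec.++ select t α)) _ (t⊆D α)

  0<μ⇒[]∈ : (D : Cube 0 → Bool) → 0ℚ ℚ.< μ 0 D → D [] ≡ true
  0<μ⇒[]∈ D 0<μ with D []
  ... | true  = refl
  ... | false = contradiction 0<μ (ℚ.<-irrefl refl)

  DensityBound⇒∃InVk : ∀ n ε k (D : Cube (k * n) → Bool) → DensityBound (τ n ε) k (μ (k * n) D) →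
                       ∃ λ (t : Tuple k n) → InVk k n ε D t
  DensityBound⇒∃InVk n ε zero    D 0<δ   = (λ ()) , (λ ()) , λ { [] → 0<μ⇒[]∈ D 0<δ }
  DensityBound⇒∃InVk n ε (suc k) D bound =
    (x₀ , x₁) ∷ᵗ proj₁ rest , InVk-∷ {k} {n} {ε} {D} {x₀} {x₁} x₁∈V (proj₂ rest)
    where
      open Fibres n (k * n) ε D
      0≤τ : 0ℚ ℚ.≤ τ n ε
      0≤τ = μ-nonNeg n _
      0≤δ = μ-nonNeg (suc k * n) D
      δ≤1 = μ≤1 (suc k * n) D
      pair = good-pair-density (DensityBound-suc⇒2τ<δ 0≤τ k 0≤δ δ≤1 bound)
      x₀ = proj₁ pair
      x₁ = proj₁ (proj₂ pair)
      x₁∈V = proj₁ (proj₂ (proj₂ pair))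
      δ²≤ = proj₂ (proj₂ (proj₂ pair))
      meet = fibreMeet x₀ x₁
      rest = DensityBound⇒∃InVk n ε k meet
        (DensityBound-step 0≤τ k 0≤δ δ≤1 (μ-nonNeg (k * n) meet) (μ≤1 (k * n) meet) δ²≤ bound)

open import Data.Bool using (Bool)
open import Data.Nat as ℕ using (ℕ)
open import Data.Rational using (ℚ; _*_; _≤_; _<_; 0ℚ; 1ℚ)
open import Data.Product using (∃)

mainTheorem11 : (n k : ℕ) → k ℕ.≤ n → (ε₁ : ℚ) → 0ℚ ≤ ε₁ → ℕ→ℚ 4 ≤ ε₁ * ε₁ * ℕ→ℚ n → ε₁ ≤ 1ℚ
    → (D : Cube (k ℕ.* n) → Bool)
    → (ℕ→ℚ (2 ℕ.^ k) * τ n ε₁) ^ℚ 2 < μ (k ℕ.* n) D ^ℚ (2 ℕ.^ k)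
    → ℕ→ℚ (3 ℕ.* k) < ε₁ * ε₁ * ℕ→ℚ n
    → ∃ λ (t : Tuple k n) → InVk k n ε₁ D t
mainTheorem11 n k _ ε₁ _ _ _ D density _ =
  DensityBound⇒∃InVk n ε₁ k D
    (DensityBound-from-square k (μ-nonNeg n _) (μ-nonNeg (k ℕ.* n) D) density)
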